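{- Let $A=(0,0)$ and $B=(m,b)\in\mathbb Z^2$ with $m>0$, and let $\eta_+,\eta_-:A\to B$ be two Dyck paths that do not intersect except at their endpoints $A$ and $B$, with $\eta_+$ above $\eta_-$. Let $\Gamma$ be the closed region between $\eta_-$ and $\eta_+$. Let $0<\ell<m$, let $\gamma=\{x=\ell\}\cap\Gamma$, and for $k\in\mathbb Z$ let $N(k)$ be the number of Dyck paths $\zeta:A\to B$ lying inside $\Gamma$ that contain the point $(\ell,k)$. Then $$N(k)^2\ \ge\ N(k+2)\,N(k-2)$$ for all $k\in\mathbb Z$ such that $(\ell,k+2)\in\gamma$ and $(\ell,k-2)\in\gamma$.
   Context: A Dyck path here is a lattice path with steps $(1,1)$ and $(1,-1)$ (no nonnegativity constraint). A path lies inside $\Gamma$ if it lies in the closed region bounded by $\eta_-$ and $\eta_+$. -}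

module Defs where

open import Data.Nat using (ℕ; zero; suc; _<_)
open import Data.Integer using (ℤ; +_; _+_; _≤_; _<_; -1ℤ; 1ℤ)
open import Data.Vec using (Vec; []; _∷_)
open import Data.List using (List; []; _∷_; map; _++_; length; filter)
open import Data.Product using (_×_)
open import Relation.Binary.PropositionalEquality using (_≡_)
open import Relation.Nullary using (Dec)

data Step : Set where
  up down : Step

stepVal : Step → ℤ
stepVal up = 1ℤ
stepVal down = -1ℤ

-- A Dyck path starting at A = (0,0) with m steps (no nonnegativity constraint).
Path : ℕ → Set
Path m = Vec Step m

-- height x p : the y-coordinate of the path p at abscissa x
-- (for x ≥ m this is the height of the endpoint).
height : ∀ {m} → ℕ → Path m → ℤ
height zero p = + 0
height (suc x) [] = + 0
height (suc x) (s ∷ p) = stepVal s + height x p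

Ends : ∀ {m} → ℤ → Path m → Set
Ends {m} b p = height m p ≡ b

StrictlyAboveInterior : ∀ {m} → Path m → Path m → Set
StrictlyAboveInterior {m} η₋ η₊ = ∀ x → 0 Data.Nat.< x → x Data.Nat.< m → height x η₋ Data.Integer.< height x η₊

allPaths : (m : ℕ) → List (Path m)
allPaths zero = [] ∷ []
allPaths (suc m) = map (up ∷_) (allPaths m) ++ map (down ∷_) (allPaths m)

open import Data.Bool using (Bool; true; false; _∧_)
open import Data.List using (upTo; foldr)
open import Relation.Nullary.Decidable using (⌊_⌋)
import Data.Integer.Properties as ℤP

insideᵇ : ∀ {m} → Path m → Path m → Path m → Bool
insideᵇ {m} η₋ η₊ ζ =
  foldr (λ x acc → acc ∧ ( ⌊ height x η₋ ℤP.≤? height x ζ ⌋ ∧ ⌊ height x ζ ℤP.≤? height x η₊ ⌋)) true (upTo (suc m))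

countedᵇ : ∀ {m} → ℤ → Path m → Path m → ℕ → ℤ → Path m → Bool
countedᵇ {m} b η₋ η₊ ℓ k ζ =
  ⌊ height m ζ ℤP.≟ b ⌋ ∧ insideᵇ η₋ η₊ ζ ∧ ⌊ height ℓ ζ ℤP.≟ k ⌋

N : ∀ {m} → ℤ → Path m → Path m → ℕ → ℤ → ℕ
N {m} b η₋ η₊ ℓ k = length (filter (λ ζ → Data.Bool._≟_ (countedᵇ b η₋ η₊ ℓ k ζ) true) (allPaths m))

InGamma : ∀ {m} → Path m → Path m → ℕ → ℤ → Set
InGamma η₋ η₊ ℓ k = (height ℓ η₋ ≤ k) × (k ≤ height ℓ η₊)

-- Take ζ₊ through (ℓ, k+2) and ζ₋ through (ℓ, k-2), both from A to B and inside Γ. Their height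
-- difference changes by 0 or ±2 per step, is 0 at both ends and 4 at ℓ, so there is a largest
-- interval [a, c] around ℓ on which it stays ≥ 2, and it equals 2 at a and at c. Exchanging the
-- steps of ζ₊ and ζ₋ between a and c gives two paths from A to B through (ℓ, k) which on [a, c]
-- lie between ζ₋ and ζ₊ (one is ζ₋ + 2, the other ζ₊ - 2), hence inside Γ. The exchanged pair
-- has the same window [a, c], so the exchange is an involution, and it injects pairs counted by
-- N(k+2) N(k-2) into pairs counted by N(k)².

module Submission where

open import Defs
open import Data.Nat using (ℕ)
open import Data.Integer using (ℤ; +_; _+_; _-_; _*_; _≤_)
import Data.Nat as Nat

open import Data.Nat using (zero; suc; z≤n; s≤s; _∸_; _≤′_; ≤′-refl; ≤′-step)
import Data.Nat.Properties as ℕP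
open import Data.Integer using (-_; 0ℤ; 1ℤ; -1ℤ; +≤+; -≤+)
import Data.Integer.Properties as ℤP
open import Algebra.Properties.CommutativeSemigroup ℤP.+-commutativeSemigroup
  using (interchange; xy∙z≈xz∙y; x∙yz≈xz∙y)
open import Algebra.Properties.AbelianGroup ℤP.+-0-abelianGroup
  using (∙-cancelˡ; ∙-cancelʳ; //-rightDividesˡ; //-rightDividesʳ)
open import Data.Bool using (Bool; true; false; if_then_else_; _∧_; T)
import Data.Bool as Bool
open import Data.Vec using ([]; _∷_)
open import Data.Vec.Properties using (∷-injectiveʳ)
open import Data.List using (List; []; _∷_; map; _++_; length; filter; cartesianProduct; foldr; upTo)
open import Data.List.Properties using (length-++; length-map; length-++-sucʳ)
open import Data.List.Membership.Propositional using (_∈_)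
open import Data.List.Membership.Propositional.Properties
  using ( ∈-map⁺; ∈-map⁻; ∈-++⁺ˡ; ∈-++⁺ʳ; ∈-++⁻; ∈-∃++; ∈-filter⁺; ∈-filter⁻
        ; ∈-cartesianProduct⁺; ∈-cartesianProduct⁻; ∈-upTo⁺; ∈-upTo⁻)
open import Data.List.Relation.Unary.Any using (here; there)
open import Data.List.Relation.Unary.All as All using ([])
open import Data.List.Relation.Unary.AllPairs using ([]; _∷_)
open import Data.List.Relation.Unary.Unique.Propositional using (Unique)
import Data.List.Relation.Unary.Unique.Propositional.Properties as Unique
open import Data.Bool.Properties using (T-∧; T-≡; ∧-identityʳ)
open import Data.Unit using (tt)
open import Data.Product using (_×_; _,_; proj₁; proj₂)
open import Data.Sum using (_⊎_; inj₁; inj₂)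
open import Data.Empty using (⊥-elim)
open import Function using (_∘_)
open import Relation.Nullary using (Dec; yes; no; does; ¬_)
open import Relation.Nullary.Decidable using (⌊_⌋; does-⇔)
open import Function.Bundles using (mk⇔; Equivalence)
open import Relation.Nullary.Reflects using (ofʸ; ofⁿ)
open import Relation.Binary.PropositionalEquality

prefixSum : (ℕ → ℤ) → ℕ → ℤ
prefixSum u zero = 0ℤ
prefixSum u (suc x) = prefixSum u x + u x

prefixSum-cong : ∀ {u v} x → (∀ i → i Nat.< x → u i ≡ v i) → prefixSum u x ≡ prefixSum v x
prefixSum-cong zero _ = refl
prefixSum-cong (suc x) u≗v =
  cong₂ _+_ (prefixSum-cong x (λ i i<x → u≗v i (ℕP.m<n⇒m<1+n i<x))) (u≗v x (ℕP.n<1+n x))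

prefixSum-suc : ∀ u x → prefixSum u (suc x) ≡ u 0 + prefixSum (u ∘ suc) x
prefixSum-suc u zero = ℤP.+-comm 0ℤ (u 0)
prefixSum-suc u (suc x) = begin
    prefixSum u (suc x) + u (suc x)            ≡⟨ cong (_+ u (suc x)) (prefixSum-suc u x) ⟩
    (u 0 + prefixSum (u ∘ suc) x) + u (suc x)  ≡⟨ ℤP.+-assoc (u 0) _ _ ⟩
    u 0 + prefixSum (u ∘ suc) (suc x)          ∎
  where open ≡-Reasoning

prefixSum-+ : ∀ u v x → prefixSum (λ i → u i + v i) x ≡ prefixSum u x + prefixSum v x
prefixSum-+ u v zero = refl
prefixSum-+ u v (suc x) =
  trans (cong (_+ (u x + v x)) (prefixSum-+ u v x)) (interchange (prefixSum u x) _ _ _)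

prefixSum-scale : ∀ c u x → prefixSum (λ i → c * u i) x ≡ c * prefixSum u x
prefixSum-scale c u zero = sym (ℤP.*-zeroʳ c)
prefixSum-scale c u (suc x) =
  trans (cong (_+ c * u x) (prefixSum-scale c u x)) (sym (ℤP.*-distribˡ-+ c _ _))

prefixSum-agree : ∀ u v {y x} → y Nat.≤ x → (∀ i → y Nat.≤ i → i Nat.< x → u i ≡ v i) →
                  prefixSum u x + prefixSum v y ≡ prefixSum v x + prefixSum u y
prefixSum-agree u v y≤x = go (ℕP.≤⇒≤′ y≤x)
  where
  go : ∀ {y x} → y ≤′ x → (∀ i → y Nat.≤ i → i Nat.< x → u i ≡ v i) →
       prefixSum u x + prefixSum v y ≡ prefixSum v x + prefixSum u y
  go {y} ≤′-refl _ = ℤP.+-comm (prefixSum u y) (prefixSum v y)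
  go {y} (≤′-step {x} y≤′x) u≗v = begin
      (prefixSum u x + u x) + prefixSum v y  ≡⟨ xy∙z≈xz∙y (prefixSum u x) _ _ ⟩
      (prefixSum u x + prefixSum v y) + u x
        ≡⟨ cong₂ _+_ (go y≤′x (λ i y≤i i<x → u≗v i y≤i (ℕP.m<n⇒m<1+n i<x))) (u≗v x (ℕP.≤′⇒≤ y≤′x) (ℕP.n<1+n x)) ⟩
      (prefixSum v x + prefixSum u y) + v x  ≡⟨ xy∙z≈xz∙y (prefixSum v x) _ _ ⟩
      (prefixSum v x + v x) + prefixSum u y  ∎
    where open ≡-Reasoning

Steps : Set
Steps = ℕ → Step

heightₛ : Steps → ℕ → ℤ
heightₛ f = prefixSum (stepVal ∘ f)

halfDiff : Step → Step → ℤ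
halfDiff up   down = 1ℤ
halfDiff down up   = -1ℤ
halfDiff _    _    = 0ℤ

halfDiff≤1 : ∀ s t → halfDiff s t ≤ 1ℤ
halfDiff≤1 up   up   = +≤+ z≤n
halfDiff≤1 up   down = ℤP.≤-refl
halfDiff≤1 down up   = -≤+
halfDiff≤1 down down = +≤+ z≤n

-1≤halfDiff : ∀ s t → -1ℤ ≤ halfDiff s t
-1≤halfDiff up   up   = -≤+
-1≤halfDiff up   down = -≤+
-1≤halfDiff down up   = ℤP.≤-refl
-1≤halfDiff down down = -≤+

stepVal-halfDiff : ∀ s t → stepVal s ≡ stepVal t + + 2 * halfDiff s t
stepVal-halfDiff up   up   = refl
stepVal-halfDiff up   down = refl
stepVal-halfDiff down up   = refl
stepVal-halfDiff down down = refl

-- Half the height difference, so that it moves in unit steps.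
gap : Steps → Steps → ℕ → ℤ
gap f g = prefixSum (λ i → halfDiff (f i) (g i))

heightₛ-gap : ∀ f g x → heightₛ f x ≡ heightₛ g x + + 2 * gap f g x
heightₛ-gap f g x = begin
    heightₛ f x
  ≡⟨ prefixSum-cong x (λ i _ → stepVal-halfDiff (f i) (g i)) ⟩
    prefixSum (λ i → stepVal (g i) + + 2 * halfDiff (f i) (g i)) x
  ≡⟨ prefixSum-+ (stepVal ∘ g) _ x ⟩
    heightₛ g x + prefixSum (λ i → + 2 * halfDiff (f i) (g i)) x
  ≡⟨ cong (λ s → heightₛ g x + s) (prefixSum-scale (+ 2) _ x) ⟩
    heightₛ g x + + 2 * gap f g x
  ∎
  where open ≡-Reasoning

-- Level-one crossings of sequences with unit steps

isOne : ℤ → Bool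
isOne z = does (z ℤP.≟ 1ℤ)

-- The largest y ∈ (0, x] with P y, or 0 if there is none.
lastBelow : (ℕ → Bool) → ℕ → ℕ
lastBelow P zero    = zero
lastBelow P (suc x) = if P (suc x) then suc x else lastBelow P x

-- The smallest y ∈ [x, x + n) with P y, or x + n if there is none.
firstFrom : (ℕ → Bool) → ℕ → ℕ → ℕ
firstFrom P x zero    = x
firstFrom P x (suc n) = if P x then x else firstFrom P (suc x) n

lastBelow-cong : ∀ {P Q} x → (∀ y → y Nat.≤ x → P y ≡ Q y) → lastBelow P x ≡ lastBelow Q x
lastBelow-cong zero    _   = refl
lastBelow-cong (suc x) P≗Q rewrite P≗Q (suc x) ℕP.≤-refl
  | lastBelow-cong x (λ y y≤x → P≗Q y (ℕP.m≤n⇒m≤1+n y≤x)) = refl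

firstFrom-cong : ∀ {P Q} x n → (∀ y → x Nat.≤ y → y Nat.< x Nat.+ n → P y ≡ Q y) →
                 firstFrom P x n ≡ firstFrom Q x n
firstFrom-cong x zero    _   = refl
firstFrom-cong x (suc n) P≗Q rewrite P≗Q x ℕP.≤-refl (ℕP.m<m+n x (s≤s z≤n))
  | firstFrom-cong (suc x) n (λ y x<y y<x+n →
      P≗Q y (ℕP.<⇒≤ x<y) (subst (y Nat.<_) (sym (ℕP.+-suc x n)) y<x+n)) = refl

AtLeastOneOn : (ℕ → ℤ) → ℕ → ℕ → Set
AtLeastOneOn e a c = ∀ y → a Nat.≤ y → y Nat.≤ c → 1ℤ ≤ e y

1≤i∧i≢1⇒2≤i : ∀ {i} → 1ℤ ≤ i → i ≢ 1ℤ → + 2 ≤ i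
1≤i∧i≢1⇒2≤i 1≤i i≢1 = ℤP.i<j⇒suc[i]≤j (ℤP.≤∧≢⇒< 1≤i (i≢1 ∘ sym))

2≤i+j∧j≤1⇒1≤i : ∀ {i j} → + 2 ≤ i + j → j ≤ 1ℤ → 1ℤ ≤ i
2≤i+j∧j≤1⇒1≤i {i} 2≤i+j j≤1 = subst (1ℤ ≤_) (//-rightDividesʳ 1ℤ i)
  (ℤP.+-monoˡ-≤ (- 1ℤ) (ℤP.≤-trans 2≤i+j (ℤP.+-monoʳ-≤ i j≤1)))

lastBelow-crossing : ∀ {u} → (∀ i → u i ≤ 1ℤ) → ∀ x → 1ℤ ≤ prefixSum u x →
  let a = lastBelow (isOne ∘ prefixSum u) x in
  prefixSum u a ≡ 1ℤ × a Nat.≤ x × AtLeastOneOn (prefixSum u) a x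
lastBelow-crossing u≤1 zero (+≤+ ())
lastBelow-crossing {u} u≤1 (suc x) 1≤e with prefixSum u (suc x) ℤP.≟ 1ℤ
... | yes e≡1 = e≡1 , ℕP.≤-refl ,
                λ y a≤y y≤a → subst (λ z → 1ℤ ≤ prefixSum u z) (ℕP.≤-antisym a≤y y≤a) 1≤e
... | no e≢1 with lastBelow-crossing u≤1 x (2≤i+j∧j≤1⇒1≤i (1≤i∧i≢1⇒2≤i 1≤e e≢1) (u≤1 x))
...   | ea , a≤x , above = ea , ℕP.m≤n⇒m≤1+n a≤x , extend
  where
  extend : AtLeastOneOn (prefixSum u) (lastBelow (isOne ∘ prefixSum u) x) (suc x)
  extend y a≤y y≤1+x with ℕP.m≤n⇒m<n∨m≡n y≤1+x
  ... | inj₁ y<1+x = above y a≤y (ℕP.≤-pred y<1+x)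
  ... | inj₂ refl  = 1≤e

firstFrom-crossing : ∀ {u} → (∀ i → -1ℤ ≤ u i) → ∀ n x →
  1ℤ ≤ prefixSum u x → prefixSum u (x Nat.+ n) ≤ 0ℤ →
  let c = firstFrom (isOne ∘ prefixSum u) x n in
  prefixSum u c ≡ 1ℤ × x Nat.≤ c × c Nat.≤ x Nat.+ n × AtLeastOneOn (prefixSum u) x c
firstFrom-crossing {u} -1≤u zero x 1≤e e≤0
  with +≤+ () ← ℤP.≤-trans 1≤e (subst (λ z → prefixSum u z ≤ 0ℤ) (ℕP.+-identityʳ x) e≤0)
firstFrom-crossing {u} -1≤u (suc n) x 1≤e e≤0 with prefixSum u x ℤP.≟ 1ℤ
... | yes e≡1 = e≡1 , ℕP.≤-refl , ℕP.m≤m+n x (suc n) ,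
                λ y x≤y y≤x → subst (λ z → 1ℤ ≤ prefixSum u z) (ℕP.≤-antisym x≤y y≤x) 1≤e
... | no e≢1 with firstFrom-crossing -1≤u n (suc x) (ℤP.+-mono-≤ (1≤i∧i≢1⇒2≤i 1≤e e≢1) (-1≤u x))
                    (subst (λ z → prefixSum u z ≤ 0ℤ) (ℕP.+-suc x n) e≤0)
...   | ec , x<c , c≤x+n , above =
  ec , ℕP.<⇒≤ x<c , subst (firstFrom (isOne ∘ prefixSum u) (suc x) n Nat.≤_) (sym (ℕP.+-suc x n)) c≤x+n , extend
  where
  extend : AtLeastOneOn (prefixSum u) x (firstFrom (isOne ∘ prefixSum u) (suc x) n)
  extend y x≤y y≤c with ℕP.m≤n⇒m<n∨m≡n x≤y
  ... | inj₁ x<y = above y x<y y≤c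
  ... | inj₂ refl = 1≤e

-- Exchanging two step sequences on a window [a, c)

swapOn : ℕ → ℕ → Steps → Steps → Steps
swapOn a c f g i = if i Nat.<ᵇ a then f i else if i Nat.<ᵇ c then g i else f i

module _ {a c : ℕ} {f g : Steps} where

  swapOn-before : ∀ {i} → i Nat.< a → swapOn a c f g i ≡ f i
  swapOn-before {i} i<a with i Nat.<ᵇ a | ℕP.<ᵇ-reflects-< i a
  ... | true  | _        = refl
  ... | false | ofⁿ i≮a = ⊥-elim (i≮a i<a)

  swapOn-inside : ∀ {i} → a Nat.≤ i → i Nat.< c → swapOn a c f g i ≡ g i
  swapOn-inside {i} a≤i i<c with i Nat.<ᵇ a | ℕP.<ᵇ-reflects-< i a | i Nat.<ᵇ c | ℕP.<ᵇ-reflects-< i c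
  ... | true  | ofʸ i<a | _     | _        = ⊥-elim (ℕP.<⇒≱ i<a a≤i)
  ... | false | _       | true  | _        = refl
  ... | false | _       | false | ofⁿ i≮c = ⊥-elim (i≮c i<c)

  swapOn-after : ∀ {i} → c Nat.≤ i → swapOn a c f g i ≡ f i
  swapOn-after {i} c≤i with i Nat.<ᵇ a | i Nat.<ᵇ c | ℕP.<ᵇ-reflects-< i c
  ... | true  | _     | _       = refl
  ... | false | true  | ofʸ i<c = ⊥-elim (ℕP.<⇒≱ i<c c≤i)
  ... | false | false | _       = refl

  swapOn-cong : ∀ {f′ g′ i} → f i ≡ f′ i → g i ≡ g′ i → swapOn a c f g i ≡ swapOn a c f′ g′ i
  swapOn-cong {i = i} f≡ g≡ with i Nat.<ᵇ a | i Nat.<ᵇ c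
  ... | true  | _     = f≡
  ... | false | true  = g≡
  ... | false | false = f≡

  swapOn-involutive : ∀ i → swapOn a c (swapOn a c f g) (swapOn a c g f) i ≡ f i
  swapOn-involutive i with i Nat.<ᵇ a | i Nat.<ᵇ c
  ... | true  | _     = refl
  ... | false | true  = refl
  ... | false | false = refl

  heightₛ-swapOn-before : ∀ {x} → x Nat.≤ a → heightₛ (swapOn a c f g) x ≡ heightₛ f x
  heightₛ-swapOn-before {x} x≤a =
    prefixSum-cong x (λ i i<x → cong stepVal (swapOn-before (ℕP.<-≤-trans i<x x≤a)))

  module _ {d : ℤ} (offset-a : heightₛ f a ≡ heightₛ g a + d) where

    heightₛ-swapOn-inside : ∀ {x} → a Nat.≤ x → x Nat.≤ c → heightₛ (swapOn a c f g) x ≡ heightₛ g x + d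
    heightₛ-swapOn-inside {x} a≤x x≤c = ∙-cancelʳ (heightₛ g a) _ _ (begin
        heightₛ (swapOn a c f g) x + heightₛ g a
      ≡⟨ prefixSum-agree (stepVal ∘ swapOn a c f g) (stepVal ∘ g) a≤x
           (λ i a≤i i<x → cong stepVal (swapOn-inside a≤i (ℕP.<-≤-trans i<x x≤c))) ⟩
        heightₛ g x + heightₛ (swapOn a c f g) a
      ≡⟨ cong (λ h → heightₛ g x + h) (trans (heightₛ-swapOn-before ℕP.≤-refl) offset-a) ⟩
        heightₛ g x + (heightₛ g a + d)
      ≡⟨ x∙yz≈xz∙y (heightₛ g x) _ _ ⟩
        (heightₛ g x + d) + heightₛ g a
      ∎)
      where open ≡-Reasoning

    heightₛ-swapOn-after : heightₛ f c ≡ heightₛ g c + d → a Nat.≤ c →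
                           ∀ {x} → c Nat.≤ x → heightₛ (swapOn a c f g) x ≡ heightₛ f x
    heightₛ-swapOn-after offset-c a≤c {x} c≤x = ∙-cancelʳ (heightₛ f c) _ _ (begin
        heightₛ (swapOn a c f g) x + heightₛ f c
      ≡⟨ prefixSum-agree (stepVal ∘ swapOn a c f g) (stepVal ∘ f) c≤x
           (λ i c≤i _ → cong stepVal (swapOn-after c≤i)) ⟩
        heightₛ f x + heightₛ (swapOn a c f g) c
      ≡⟨ cong (λ h → heightₛ f x + h) (trans (heightₛ-swapOn-inside a≤c ℕP.≤-refl) (sym offset-c)) ⟩
        heightₛ f x + heightₛ f c
      ∎)
      where open ≡-Reasoning

stepAt : ∀ {n} → Path n → Steps
stepAt []      _       = up    -- never inspected
stepAt (s ∷ p) zero    = s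
stepAt (s ∷ p) (suc i) = stepAt p i

fromSteps : ∀ {n} → Steps → Path n
fromSteps {zero}  f = []
fromSteps {suc n} f = f 0 ∷ fromSteps (f ∘ suc)

stepAt-fromSteps : ∀ {n} f {i} → i Nat.< n → stepAt (fromSteps {n} f) i ≡ f i
stepAt-fromSteps {suc n} f {zero}  _         = refl
stepAt-fromSteps {suc n} f {suc i} (s≤s i<n) = stepAt-fromSteps (f ∘ suc) i<n

fromSteps-stepAt : ∀ {n} (p : Path n) {f} → (∀ i → i Nat.< n → f i ≡ stepAt p i) → fromSteps f ≡ p
fromSteps-stepAt []      _   = refl
fromSteps-stepAt (s ∷ p) f≗p =
  cong₂ _∷_ (f≗p 0 (s≤s z≤n)) (fromSteps-stepAt p (λ i i<n → f≗p (suc i) (s≤s i<n)))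

height-heightₛ : ∀ {n} (p : Path n) {x} → x Nat.≤ n → height x p ≡ heightₛ (stepAt p) x
height-heightₛ p       {zero}  _         = refl
height-heightₛ (s ∷ p) {suc x} (s≤s x≤n) =
  trans (cong (λ h → stepVal s + h) (height-heightₛ p x≤n)) (sym (prefixSum-suc (stepVal ∘ stepAt (s ∷ p)) x))

height-fromSteps : ∀ {n} f {x} → x Nat.≤ n → height x (fromSteps {n} f) ≡ heightₛ f x
height-fromSteps f {x} x≤n = trans (height-heightₛ (fromSteps f) x≤n)
  (prefixSum-cong x (λ i i<x → cong stepVal (stepAt-fromSteps f (ℕP.<-≤-trans i<x x≤n))))

swapPaths : ∀ {m} → ℕ → ℕ → Path m × Path m → Path m × Path m
swapPaths a c (p , q) =
  fromSteps (swapOn a c (stepAt p) (stepAt q)) , fromSteps (swapOn a c (stepAt q) (stepAt p))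

swapPaths-involutive : ∀ {m} a c (pq : Path m × Path m) → swapPaths a c (swapPaths a c pq) ≡ pq
swapPaths-involutive {m} a c (p , q) = cong₂ _,_ (swapBack p q) (swapBack q p)
  where
  swapBack : ∀ (r s : Path m) → proj₁ (swapPaths a c (swapPaths a c (r , s))) ≡ r
  swapBack r s = fromSteps-stepAt r (λ i i<m → trans
    (swapOn-cong {a} {c} {stepAt r′} {stepAt s′} {swapOn a c (stepAt r) (stepAt s)}
       {swapOn a c (stepAt s) (stepAt r)} (stepAt-fromSteps _ i<m) (stepAt-fromSteps _ i<m))
    (swapOn-involutive {a} {c} {stepAt r} {stepAt s} i))
    where
    r′ s′ : Path m
    r′ = fromSteps (swapOn a c (stepAt r) (stepAt s))
    s′ = fromSteps (swapOn a c (stepAt s) (stepAt r))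

height-gap : ∀ {m} (p q : Path m) {x} → x Nat.≤ m →
             height x p ≡ height x q + + 2 * gap (stepAt p) (stepAt q) x
height-gap p q {x} x≤m = begin
    height x p                           ≡⟨ height-heightₛ p x≤m ⟩
    heightₛ (stepAt p) x                 ≡⟨ heightₛ-gap (stepAt p) (stepAt q) x ⟩
    heightₛ (stepAt q) x + + 2 * gap₍x₎  ≡⟨ cong (_+ + 2 * gap₍x₎) (height-heightₛ q x≤m) ⟨
    height x q + + 2 * gap₍x₎            ∎
  where
  open ≡-Reasoning
  gap₍x₎ : ℤ
  gap₍x₎ = gap (stepAt p) (stepAt q) x

gap-from-heights : ∀ {m} (p q : Path m) {x d} → x Nat.≤ m →
                   height x p ≡ height x q + + 2 * d → gap (stepAt p) (stepAt q) x ≡ d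
gap-from-heights p q {x} {d} x≤m p≡q+2d =
  ℤP.*-cancelˡ-≡ (+ 2) _ d (∙-cancelˡ (height x q) _ _ (trans (sym (height-gap p q x≤m)) p≡q+2d))

twoAbove : ∀ {m} → Path m → Path m → ℕ → Bool
twoAbove p q y = does (height y p ℤP.≟ height y q + + 2)

-- Whether the gap is 1 depends on the heights only; this is how the window is seen to survive the exchange.
twoAbove-isOne : ∀ {m} (p q : Path m) {y} → y Nat.≤ m → twoAbove p q y ≡ isOne (gap (stepAt p) (stepAt q) y)
twoAbove-isOne p q {y} y≤m = does-⇔ (mk⇔ (gap-from-heights p q y≤m)
  (λ gap≡1 → trans (height-gap p q y≤m) (cong (λ g → height y q + + 2 * g) gap≡1)))
  (height y p ℤP.≟ height y q + + 2) (gap (stepAt p) (stepAt q) y ℤP.≟ 1ℤ)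

window-trichotomy : ∀ a c x → (x Nat.≤ a ⊎ c Nat.≤ x) ⊎ (a Nat.≤ x × x Nat.≤ c)
window-trichotomy a c x with x Nat.≤? a | c Nat.≤? x
... | yes x≤a | _       = inj₁ (inj₁ x≤a)
... | no _    | yes c≤x = inj₁ (inj₂ c≤x)
... | no x≰a  | no c≰x  = inj₂ (ℕP.<⇒≤ (ℕP.≰⇒> x≰a) , ℕP.<⇒≤ (ℕP.≰⇒> c≰x))

InsideΓ : ∀ {m} → Path m → Path m → Path m → Set
InsideΓ {m} η₋ η₊ ζ = ∀ x → x Nat.≤ m → height x η₋ ≤ height x ζ × height x ζ ≤ height x η₊

Counted : ∀ {m} → ℤ → Path m → Path m → ℕ → ℤ → Path m → Set
Counted b η₋ η₊ ℓ k ζ = Ends b ζ × InsideΓ η₋ η₊ ζ × height ℓ ζ ≡ k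

windowStart : ∀ {m} → ℕ → Path m → Path m → ℕ
windowStart ℓ p q = lastBelow (isOne ∘ gap (stepAt p) (stepAt q)) ℓ

windowEnd : ∀ {m} → ℕ → Path m → Path m → ℕ
windowEnd {m} ℓ p q = firstFrom (isOne ∘ gap (stepAt p) (stepAt q)) ℓ (m ∸ ℓ)

swapWindow : ∀ {m} → ℕ → Path m × Path m → Path m × Path m
swapWindow ℓ (p , q) = swapPaths (windowStart ℓ p q) (windowEnd ℓ p q) (p , q)

module SwapWindow {m ℓ : ℕ} (ℓ≤m : ℓ Nat.≤ m) (p q : Path m)
                  (apart : height ℓ p ≡ height ℓ q + + 4) (meet : height m p ≡ height m q) where

  private
    f g : Steps
    f = stepAt p
    g = stepAt q

    e : ℕ → ℤ
    e = gap f g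

    a c : ℕ
    a = windowStart ℓ p q
    c = windowEnd ℓ p q

    ℓ+[m∸ℓ]≡m : ℓ Nat.+ (m ∸ ℓ) ≡ m
    ℓ+[m∸ℓ]≡m = ℕP.m+[n∸m]≡n ℓ≤m

    1≤e[ℓ] : 1ℤ ≤ e ℓ
    1≤e[ℓ] = subst (1ℤ ≤_) (sym (gap-from-heights p q {d = + 2} ℓ≤m apart)) (+≤+ (s≤s z≤n))

    e[m]≤0 : e (ℓ Nat.+ (m ∸ ℓ)) ≤ 0ℤ
    e[m]≤0 rewrite ℓ+[m∸ℓ]≡m =
      ℤP.≤-reflexive (gap-from-heights p q ℕP.≤-refl (trans meet (sym (ℤP.+-identityʳ _))))

    start : e a ≡ 1ℤ × a Nat.≤ ℓ × AtLeastOneOn e a ℓ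
    start = lastBelow-crossing (λ i → halfDiff≤1 (f i) (g i)) ℓ 1≤e[ℓ]

    end : e c ≡ 1ℤ × ℓ Nat.≤ c × c Nat.≤ ℓ Nat.+ (m ∸ ℓ) × AtLeastOneOn e ℓ c
    end = firstFrom-crossing (λ i → -1≤halfDiff (f i) (g i)) (m ∸ ℓ) ℓ 1≤e[ℓ] e[m]≤0

    a≤c : a Nat.≤ c
    a≤c = ℕP.≤-trans (proj₁ (proj₂ start)) (proj₁ (proj₂ end))

    e≥1 : AtLeastOneOn e a c
    e≥1 y a≤y y≤c with y Nat.≤? ℓ
    ... | yes y≤ℓ = proj₂ (proj₂ start) y a≤y y≤ℓ
    ... | no y≰ℓ  = proj₂ (proj₂ (proj₂ end)) y (ℕP.<⇒≤ (ℕP.≰⇒> y≰ℓ)) y≤c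

    offset : ∀ {x} → e x ≡ 1ℤ → heightₛ f x ≡ heightₛ g x + + 2
    offset {x} e≡1 = trans (heightₛ-gap f g x) (cong (λ d → heightₛ g x + + 2 * d) e≡1)

    flip-offset : ∀ {x y} → x ≡ y + + 2 → y ≡ x + - + 2
    flip-offset {y = y} x≡y+2 = sym (trans (cong (_+ - + 2) x≡y+2) (//-rightDividesʳ (+ 2) y))

    offset-a : heightₛ f a ≡ heightₛ g a + + 2
    offset-a = offset {a} (proj₁ start)

    offset-c : heightₛ f c ≡ heightₛ g c + + 2
    offset-c = offset {c} (proj₁ end)

  p′ q′ : Path m
  p′ = proj₁ (swapWindow ℓ (p , q))
  q′ = proj₂ (swapWindow ℓ (p , q))

  c≤m : c Nat.≤ m
  c≤m = subst (c Nat.≤_) ℓ+[m∸ℓ]≡m (proj₁ (proj₂ (proj₂ end)))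

  ℓ-inside : a Nat.≤ ℓ × ℓ Nat.≤ c
  ℓ-inside = proj₁ (proj₂ start) , proj₁ (proj₂ end)

  private
    swapped-outside : ∀ {f₁ g₁ d x} → heightₛ f₁ a ≡ heightₛ g₁ a + d → heightₛ f₁ c ≡ heightₛ g₁ c + d →
                      x Nat.≤ a ⊎ c Nat.≤ x → heightₛ (swapOn a c f₁ g₁) x ≡ heightₛ f₁ x
    swapped-outside {f₁} {g₁} _ _ (inj₁ x≤a) = heightₛ-swapOn-before {a} {c} {f₁} {g₁} x≤a
    swapped-outside       off-a off-c (inj₂ c≤x) = heightₛ-swapOn-after off-a off-c a≤c c≤x

  unchanged : ∀ {x} → x Nat.≤ m → x Nat.≤ a ⊎ c Nat.≤ x →
              height x p′ ≡ height x p × height x q′ ≡ height x q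
  unchanged x≤m outside =
    trans (height-fromSteps _ x≤m)
          (trans (swapped-outside offset-a offset-c outside) (sym (height-heightₛ p x≤m))) ,
    trans (height-fromSteps _ x≤m)
          (trans (swapped-outside (flip-offset offset-a) (flip-offset offset-c) outside) (sym (height-heightₛ q x≤m)))

  exchanged : ∀ {x} → a Nat.≤ x → x Nat.≤ c →
              height x p′ ≡ height x q + + 2 × height x q′ ≡ height x p + - + 2
  exchanged {x} a≤x x≤c =
    trans (height-fromSteps _ x≤m) (trans (heightₛ-swapOn-inside offset-a a≤x x≤c)
                                          (cong (_+ + 2) (sym (height-heightₛ q x≤m)))) ,
    trans (height-fromSteps _ x≤m) (trans (heightₛ-swapOn-inside (flip-offset offset-a) a≤x x≤c)
                                          (cong (_+ - + 2) (sym (height-heightₛ p x≤m))))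
    where
    x≤m : x Nat.≤ m
    x≤m = ℕP.≤-trans x≤c c≤m

  separated : ∀ {x} → a Nat.≤ x → x Nat.≤ c → height x q + + 2 ≤ height x p
  separated {x} a≤x x≤c = subst (height x q + + 2 ≤_) (sym (height-gap p q (ℕP.≤-trans x≤c c≤m)))
    (ℤP.+-monoʳ-≤ (height x q) (ℤP.*-monoˡ-≤-nonNeg (+ 2) (e≥1 x a≤x x≤c)))

  private
    twoAbove-swapWindow : ∀ {y} → y Nat.≤ m → twoAbove p′ q′ y ≡ twoAbove p q y
    twoAbove-swapWindow {y} y≤m with window-trichotomy a c y
    ... | inj₁ outside with p′≡p , q′≡q ← unchanged y≤m outside =
      cong₂ (λ s t → does (s ℤP.≟ t + + 2)) p′≡p q′≡q
    ... | inj₂ (a≤y , y≤c) with p′≡q+2 , q′≡p-2 ← exchanged a≤y y≤c =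
      does-⇔ (mk⇔ (λ eq → trans p≡q′+2 (trans (sym eq) p′≡q+2)) (λ eq → trans p′≡q+2 (trans (sym eq) p≡q′+2)))
             (height y p′ ℤP.≟ height y q′ + + 2) (height y p ℤP.≟ height y q + + 2)
      where
      p≡q′+2 : height y p ≡ height y q′ + + 2
      p≡q′+2 = trans (sym (//-rightDividesˡ (+ 2) (height y p))) (cong (_+ + 2) (sym q′≡p-2))

    crossings-swapWindow : ∀ {y} → y Nat.≤ m → isOne (gap (stepAt p′) (stepAt q′) y) ≡ isOne (e y)
    crossings-swapWindow y≤m =
      trans (sym (twoAbove-isOne p′ q′ y≤m)) (trans (twoAbove-swapWindow y≤m) (twoAbove-isOne p q y≤m))

  swapWindow-involutive : swapWindow ℓ (p′ , q′) ≡ (p , q)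
  swapWindow-involutive = trans
    (cong₂ (λ a′ c′ → swapPaths a′ c′ (p′ , q′))
      (lastBelow-cong ℓ (λ y y≤ℓ → crossings-swapWindow (ℕP.≤-trans y≤ℓ ℓ≤m)))
      (firstFrom-cong ℓ (m ∸ ℓ) (λ y _ y<m → crossings-swapWindow (ℕP.<⇒≤ (subst (y Nat.<_) ℓ+[m∸ℓ]≡m y<m)))))
    (swapPaths-involutive a c (p , q))

  module _ {η₋ η₊ : Path m} (p-inside : InsideΓ η₋ η₊ p) (q-inside : InsideΓ η₋ η₊ q) where

    p′-inside : InsideΓ η₋ η₊ p′
    p′-inside x x≤m with window-trichotomy a c x
    ... | inj₁ outside rewrite proj₁ (unchanged x≤m outside) = p-inside x x≤m
    ... | inj₂ (a≤x , x≤c) rewrite proj₁ (exchanged a≤x x≤c) =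
      ℤP.≤-trans (proj₁ (q-inside x x≤m)) (ℤP.i≤i+j _ (+ 2)) ,
      ℤP.≤-trans (separated a≤x x≤c) (proj₂ (p-inside x x≤m))

    q′-inside : InsideΓ η₋ η₊ q′
    q′-inside x x≤m with window-trichotomy a c x
    ... | inj₁ outside rewrite proj₂ (unchanged x≤m outside) = q-inside x x≤m
    ... | inj₂ (a≤x , x≤c) rewrite proj₂ (exchanged a≤x x≤c) =
      ℤP.≤-trans (proj₁ (q-inside x x≤m)) (subst (_≤ height x p + - + 2) (//-rightDividesʳ (+ 2) (height x q))
                                                  (ℤP.+-monoˡ-≤ (- + 2) (separated a≤x x≤c))) ,
      ℤP.≤-trans (ℤP.i-j≤i (height x p) (+ 2)) (proj₂ (p-inside x x≤m))

module _ {m b} {η₋ η₊ : Path m} {ℓ k} (ℓ≤m : ℓ Nat.≤ m) {p q : Path m}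
         (p-counted : Counted b η₋ η₊ ℓ (k + + 2) p) (q-counted : Counted b η₋ η₊ ℓ (k - + 2) q) where

  private
    apart : height ℓ p ≡ height ℓ q + + 4
    apart = trans (proj₂ (proj₂ p-counted))
                  (trans (sym (ℤP.+-assoc k (- + 2) (+ 4))) (cong (_+ + 4) (sym (proj₂ (proj₂ q-counted)))))

    open SwapWindow ℓ≤m p q apart (trans (proj₁ p-counted) (sym (proj₁ q-counted)))

  swapWindow-counted : Counted b η₋ η₊ ℓ k (proj₁ (swapWindow ℓ (p , q))) ×
                       Counted b η₋ η₊ ℓ k (proj₂ (swapWindow ℓ (p , q)))
  swapWindow-counted =
    ( trans (proj₁ (unchanged ℕP.≤-refl (inj₂ c≤m))) (proj₁ p-counted)
    , p′-inside (proj₁ (proj₂ p-counted)) (proj₁ (proj₂ q-counted))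
    , trans (proj₁ (exchanged (proj₁ ℓ-inside) (proj₂ ℓ-inside)))
            (trans (cong (_+ + 2) (proj₂ (proj₂ q-counted))) (//-rightDividesˡ (+ 2) k)) )
    , ( trans (proj₂ (unchanged ℕP.≤-refl (inj₂ c≤m))) (proj₁ q-counted)
    , q′-inside (proj₁ (proj₂ p-counted)) (proj₁ (proj₂ q-counted))
    , trans (proj₂ (exchanged (proj₁ ℓ-inside) (proj₂ ℓ-inside)))
            (trans (cong (_+ - + 2) (proj₂ (proj₂ p-counted))) (//-rightDividesʳ (+ 2) k)) )

  swapWindow-involutive-on-counted : swapWindow ℓ (swapWindow ℓ (p , q)) ≡ (p , q)
  swapWindow-involutive-on-counted = swapWindow-involutive

allPaths-complete : ∀ {m} (p : Path m) → p ∈ allPaths m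
allPaths-complete []                = here refl
allPaths-complete {suc m} (up ∷ p)   = ∈-++⁺ˡ (∈-map⁺ (up ∷_) (allPaths-complete p))
allPaths-complete {suc m} (down ∷ p) =
  ∈-++⁺ʳ (map (up ∷_) (allPaths m)) (∈-map⁺ (down ∷_) (allPaths-complete p))

allPaths-unique : ∀ m → Unique (allPaths m)
allPaths-unique zero    = [] ∷ []
allPaths-unique (suc m) =
  Unique.++⁺ (Unique.map⁺ ∷-injectiveʳ (allPaths-unique m)) (Unique.map⁺ ∷-injectiveʳ (allPaths-unique m))
             disjoint
  where
  disjoint : ∀ {v} → ¬ (v ∈ map (up ∷_) (allPaths m) × v ∈ map (down ∷_) (allPaths m))
  disjoint (i , j) with ∈-map⁻ (up ∷_) i | ∈-map⁻ (down ∷_) j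
  ... | _ , _ , refl | _ , _ , ()

injectiveOn⇒length-≤ : ∀ {A B : Set} (φ : A → B) (xs : List A) (ys : List B) → Unique xs →
                       (∀ {x} → x ∈ xs → φ x ∈ ys) → (∀ {x y} → x ∈ xs → y ∈ xs → φ x ≡ φ y → x ≡ y) →
                       length xs Nat.≤ length ys
injectiveOn⇒length-≤ φ []       ys _           _    _         = z≤n
injectiveOn⇒length-≤ φ (x ∷ xs) ys (x∉xs ∷ xs!) into injective with ∈-∃++ (into (here refl))
... | ys₁ , ys₂ , refl = subst (suc (length xs) Nat.≤_) (sym (length-++-sucʳ ys₁ (φ x) ys₂))
  (s≤s (injectiveOn⇒length-≤ φ xs (ys₁ ++ ys₂) xs!
    (λ y∈xs → drop-φx (into (there y∈xs))
                (λ φy≡φx → All.lookup x∉xs y∈xs (injective (here refl) (there y∈xs) (sym φy≡φx))))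
    (λ i j → injective (there i) (there j))))
  where
  drop-φx : ∀ {z} → z ∈ ys₁ ++ φ x ∷ ys₂ → z ≢ φ x → z ∈ ys₁ ++ ys₂
  drop-φx z∈ z≢φx with ∈-++⁻ ys₁ z∈
  ... | inj₁ z∈ys₁         = ∈-++⁺ˡ z∈ys₁
  ... | inj₂ (here z≡φx)   = ⊥-elim (z≢φx z≡φx)
  ... | inj₂ (there z∈ys₂) = ∈-++⁺ʳ ys₁ z∈ys₂

length-cartesianProduct : ∀ {A B : Set} (xs : List A) (ys : List B) →
                          length (cartesianProduct xs ys) ≡ length xs Nat.* length ys
length-cartesianProduct []       ys = refl
length-cartesianProduct (x ∷ xs) ys =
  trans (length-++ (map (x ,_) ys)) (cong₂ Nat._+_ (length-map (x ,_) ys) (length-cartesianProduct xs ys))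

module _ (Q : ℕ → Bool) where

  T-foldr-∧⁻ : ∀ xs → T (foldr (λ x acc → acc ∧ Q x) true xs) → ∀ {x} → x ∈ xs → T (Q x)
  T-foldr-∧⁻ (y ∷ ys) h x∈ with Equivalence.to (T-∧ {foldr (λ x acc → acc ∧ Q x) true ys} {Q y}) h | x∈
  ... | _ , Qy  | here refl   = Qy
  ... | all , _ | there x∈ys = T-foldr-∧⁻ ys all x∈ys

  T-foldr-∧⁺ : ∀ xs → (∀ {x} → x ∈ xs → T (Q x)) → T (foldr (λ x acc → acc ∧ Q x) true xs)
  T-foldr-∧⁺ []       _ = tt
  T-foldr-∧⁺ (y ∷ ys) h =
    Equivalence.from (T-∧ {foldr (λ x acc → acc ∧ Q x) true ys} {Q y})
                     (T-foldr-∧⁺ ys (h ∘ there) , h (here refl))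

module _ {m : ℕ} (η₋ η₊ ζ : Path m) where

  private
    boundsᵇ : ℕ → Bool
    boundsᵇ x = ⌊ height x η₋ ℤP.≤? height x ζ ⌋ ∧ ⌊ height x ζ ℤP.≤? height x η₊ ⌋

    boundsᵇ-sound : ∀ x → T (boundsᵇ x) → height x η₋ ≤ height x ζ × height x ζ ≤ height x η₊
    boundsᵇ-sound x h with height x η₋ ℤP.≤? height x ζ | height x ζ ℤP.≤? height x η₊
    ... | yes lower | yes upper = lower , upper

    boundsᵇ-complete : ∀ x → height x η₋ ≤ height x ζ × height x ζ ≤ height x η₊ → T (boundsᵇ x)
    boundsᵇ-complete x (lower , upper) with height x η₋ ℤP.≤? height x ζ | height x ζ ℤP.≤? height x η₊
    ... | yes _    | yes _    = tt
    ... | no lower̸ | _        = lower̸ lower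
    ... | yes _    | no upper̸ = upper̸ upper

  insideᵇ-sound : T (insideᵇ η₋ η₊ ζ) → InsideΓ η₋ η₊ ζ
  insideᵇ-sound h x x≤m = boundsᵇ-sound x (T-foldr-∧⁻ boundsᵇ (upTo (suc m)) h (∈-upTo⁺ (s≤s x≤m)))

  insideᵇ-complete : InsideΓ η₋ η₊ ζ → T (insideᵇ η₋ η₊ ζ)
  insideᵇ-complete inside =
    T-foldr-∧⁺ boundsᵇ (upTo (suc m)) λ {x} x∈ → boundsᵇ-complete x (inside x (ℕP.≤-pred (∈-upTo⁻ x∈)))

module _ {m : ℕ} (b : ℤ) (η₋ η₊ : Path m) (ℓ : ℕ) (k : ℤ) (ζ : Path m) where

  countedᵇ-sound : countedᵇ b η₋ η₊ ℓ k ζ ≡ true → Counted b η₋ η₊ ℓ k ζ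
  countedᵇ-sound h with height m ζ ℤP.≟ b | insideᵇ η₋ η₊ ζ in inside | height ℓ ζ ℤP.≟ k
  ... | yes ends | true | yes passes = ends , insideᵇ-sound η₋ η₊ ζ (subst T (sym inside) tt) , passes

  countedᵇ-complete : Counted b η₋ η₊ ℓ k ζ → countedᵇ b η₋ η₊ ℓ k ζ ≡ true
  countedᵇ-complete (ends , inside , passes) with height m ζ ℤP.≟ b | height ℓ ζ ℤP.≟ k
  ... | yes _   | yes _    = trans (∧-identityʳ _) (Equivalence.to T-≡ (insideᵇ-complete η₋ η₊ ζ inside))
  ... | no ends̸ | _        = ⊥-elim (ends̸ ends)
  ... | yes _   | no passes̸ = ⊥-elim (passes̸ passes)

module Counting {m : ℕ} (b : ℤ) (η₋ η₊ : Path m) (ℓ : ℕ) where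

  counted? : ∀ k ζ → Dec (countedᵇ b η₋ η₊ ℓ k ζ ≡ true)
  counted? k ζ = countedᵇ b η₋ η₊ ℓ k ζ Bool.≟ true

  paths : ℤ → List (Path m)
  paths k = filter (counted? k) (allPaths m)

  ∈-paths⁻ : ∀ {k ζ} → ζ ∈ paths k → Counted b η₋ η₊ ℓ k ζ
  ∈-paths⁻ {k} {ζ} ζ∈ = countedᵇ-sound b η₋ η₊ ℓ k ζ (proj₂ (∈-filter⁻ (counted? k) {xs = allPaths m} ζ∈))

  ∈-paths⁺ : ∀ {k ζ} → Counted b η₋ η₊ ℓ k ζ → ζ ∈ paths k
  ∈-paths⁺ {k} {ζ} counted = ∈-filter⁺ (counted? k) (allPaths-complete ζ) (countedᵇ-complete b η₋ η₊ ℓ k ζ counted)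

  paths-unique : ∀ k → Unique (paths k)
  paths-unique k = Unique.filter⁺ (counted? k) (allPaths-unique m)

  length-paths-*-≤ : ∀ {k₁ k₂ k} (φ ψ : Path m × Path m → Path m × Path m) →
    (∀ {p q} → Counted b η₋ η₊ ℓ k₁ p → Counted b η₋ η₊ ℓ k₂ q →
               Counted b η₋ η₊ ℓ k (proj₁ (φ (p , q))) × Counted b η₋ η₊ ℓ k (proj₂ (φ (p , q)))) →
    (∀ {p q} → Counted b η₋ η₊ ℓ k₁ p → Counted b η₋ η₊ ℓ k₂ q → ψ (φ (p , q)) ≡ (p , q)) →
    length (paths k₁) Nat.* length (paths k₂) Nat.≤ length (paths k) Nat.* length (paths k)
  length-paths-*-≤ {k₁} {k₂} {k} φ ψ φ-counted ψ∘φ≡id =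
    subst₂ Nat._≤_ (length-cartesianProduct (paths k₁) (paths k₂))
                   (length-cartesianProduct (paths k) (paths k))
      (injectiveOn⇒length-≤ φ (cartesianProduct (paths k₁) (paths k₂)) (cartesianProduct (paths k) (paths k))
        (Unique.cartesianProduct⁺ (paths-unique k₁) (paths-unique k₂)) into injective)
    where
    counted : ∀ {pq} → pq ∈ cartesianProduct (paths k₁) (paths k₂) →
              Counted b η₋ η₊ ℓ k₁ (proj₁ pq) × Counted b η₋ η₊ ℓ k₂ (proj₂ pq)
    counted pq∈ with p∈ , q∈ ← ∈-cartesianProduct⁻ (paths k₁) (paths k₂) pq∈ = ∈-paths⁻ p∈ , ∈-paths⁻ q∈

    into : ∀ {pq} → pq ∈ cartesianProduct (paths k₁) (paths k₂) → φ pq ∈ cartesianProduct (paths k) (paths k)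
    into pq∈ with p-counted , q-counted ← counted pq∈ with p′ , q′ ← φ-counted p-counted q-counted =
      ∈-cartesianProduct⁺ (∈-paths⁺ p′) (∈-paths⁺ q′)

    injective : ∀ {pq pq′} → pq ∈ cartesianProduct (paths k₁) (paths k₂) →
                pq′ ∈ cartesianProduct (paths k₁) (paths k₂) → φ pq ≡ φ pq′ → pq ≡ pq′
    injective pq∈ pq′∈ φ≡ = trans (sym (retract pq∈)) (trans (cong ψ φ≡) (retract pq′∈))
      where
      retract : ∀ {pq} → pq ∈ cartesianProduct (paths k₁) (paths k₂) → ψ (φ pq) ≡ pq
      retract pq∈ = ψ∘φ≡id (proj₁ (counted pq∈)) (proj₂ (counted pq∈))

corollary4p3 : (m : ℕ) → 0 Nat.< m → (b : ℤ) → (η₋ η₊ : Path m) →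
    Ends b η₋ → Ends b η₊ → StrictlyAboveInterior η₋ η₊ →
    (ℓ : ℕ) → 0 Nat.< ℓ → ℓ Nat.< m → (k : ℤ) →
    InGamma η₋ η₊ ℓ (k + + 2) → InGamma η₋ η₊ ℓ (k - + 2) →
    N b η₋ η₊ ℓ (k + + 2) Nat.* N b η₋ η₊ ℓ (k - + 2) Nat.≤ N b η₋ η₊ ℓ k Nat.* N b η₋ η₊ ℓ k
corollary4p3 m _ b η₋ η₊ _ _ _ ℓ _ ℓ<m k _ _ =
  length-paths-*-≤ (swapWindow ℓ) (swapWindow ℓ)
    (swapWindow-counted {k = k} ℓ≤m) (swapWindow-involutive-on-counted {k = k} ℓ≤m)
  where
  open Counting b η₋ η₊ ℓ
  ℓ≤m : ℓ Nat.≤ m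
  ℓ≤m = ℕP.<⇒≤ ℓ<m
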